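{- Let $i\ge1$ and let $a_1,\dots,a_i\in\mathbb{N}$ and $b_1,\dots,b_i\in\mathbb{N}$ be such that $b_j=0$ if and only if $a_j=0$, and such that $$\frac{a_1}{\sqrt{b_1}}\geq\frac{a_2}{\sqrt{b_2}}\geq\cdots\geq\frac{a_i}{\sqrt{b_i}},$$ with the convention $0/0=0$. Then $$\frac{a_1}{\sqrt{b_1}}+\frac12\sum_{j=2}^{i}\frac{a_j}{\sqrt{b_j}}\geq\frac{\sum_{j=1}^{i}a_j}{\sqrt{\sum_{j=1}^{i}b_j}}.$$
   Context: The convention $0/0=0$ applies throughout, including to the right-hand side when all $b_j$ are $0$. -}

module Defs where

open import Data.Nat as ℕ using (ℕ; zero; suc)
open import Data.Integer using (+_)
open import Data.Fin using (Fin; zero; suc)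
open import Data.Rational using (ℚ; 0ℚ; _/_; _+_; _*_; _≤_)
open import Data.Product using (_×_)

-- sqRatio a b = (a / √b)² = a² / b, with the convention 0/0 = 0
-- (value 0 whenever b = 0).
sqRatio : ℕ → ℕ → ℚ
sqRatio a zero    = 0ℚ
sqRatio a (suc k) = + (a ℕ.* a) / suc k

-- u is an upper bound for the real number a / √b (with 0/0 = 0):
-- u ≥ 0 and u² ≥ a²/b.  Since a/√b ≥ 0, this holds iff u ≥ a/√b.
UpperBoundOfRatio : ℕ → ℕ → ℚ → Set
UpperBoundOfRatio a b u = (0ℚ ≤ u) × (sqRatio a b ≤ u * u)

sumℕ : ∀ {n} → (Fin n → ℕ) → ℕ
sumℕ {zero}  f = 0
sumℕ {suc n} f = f zero ℕ.+ sumℕ (λ j → f (suc j))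

sumℚ : ∀ {n} → (Fin n → ℚ) → ℚ
sumℚ {zero}  f = 0ℚ
sumℚ {suc n} f = f zero + sumℚ (λ j → f (suc j))

{-# OPTIONS --safe #-}
-- Titu's lemma (the Engel form of Cauchy–Schwarz) gives (Σ a)²/Σ b ≤ Σ sⱼ with sⱼ = aⱼ²/bⱼ.
-- Counting from 0, s₀ ≤ u₀², and every later sⱼ is at most both s₀ ≤ u₀² and uⱼ², hence at most u₀ uⱼ.
-- So Σ sⱼ ≤ u₀² + u₀ T with T = Σ_{j>0} uⱼ, and u₀² + u₀ T ≤ (u₀ + T/2)².
module Submission where

open import Defs
open import Data.Nat using (ℕ; suc)
open import Data.Fin using (Fin; zero; suc; _<_)
open import Data.Rational using (ℚ; ½; _+_; _*_; _≤_)
open import Data.Product using (_×_)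
open import Function.Bundles using (_⇔_)
open import Relation.Binary.PropositionalEquality using (_≡_)

open import Data.Nat as ℕ using (zero)
import Data.Nat.Properties as ℕ
open import Data.Nat.Solver using (module +-*-Solver)
open import Data.Integer as ℤ using (+_)
import Data.Integer.Properties as ℤ
open import Data.Rational using (0ℚ; fromℚᵘ; nonNegative; nonPositive)
open import Data.Rational.Properties
open import Data.Rational.Solver renaming (module +-*-Solver to ℚ-Solver)
open import Data.Rational.Unnormalised as ℚᵘ using (ℚᵘ; mkℚᵘ; *≤*)
import Data.Rational.Unnormalised.Properties as ℚᵘ
open import Data.Product using (_,_; proj₁; proj₂)
open import Data.Sum using (inj₁; inj₂)
open import Function.Bundles using (module Equivalence)
open import Relation.Binary.PropositionalEquality using (refl; sym; trans; cong; cong₂; subst₂)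

m≤n⇒m*n+m*n≤m*m+n*n : ∀ {m n} → m ℕ.≤ n → m ℕ.* n ℕ.+ m ℕ.* n ℕ.≤ m ℕ.* m ℕ.+ n ℕ.* n
m≤n⇒m*n+m*n≤m*m+n*n {m} m≤n with ℕ.m≤n⇒∃[o]m+o≡n m≤n
... | d , refl = begin
  m ℕ.* (m ℕ.+ d) ℕ.+ m ℕ.* (m ℕ.+ d)            ≤⟨ ℕ.m≤m+n _ (d ℕ.* d) ⟩
  m ℕ.* (m ℕ.+ d) ℕ.+ m ℕ.* (m ℕ.+ d) ℕ.+ d ℕ.* d ≡⟨ expand m d ⟩
  m ℕ.* m ℕ.+ (m ℕ.+ d) ℕ.* (m ℕ.+ d)            ∎
  where
  open ℕ.≤-Reasoning
  open +-*-Solver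
  expand : ∀ m d → m ℕ.* (m ℕ.+ d) ℕ.+ m ℕ.* (m ℕ.+ d) ℕ.+ d ℕ.* d ≡ m ℕ.* m ℕ.+ (m ℕ.+ d) ℕ.* (m ℕ.+ d)
  expand = solve 2 (λ m d → m :* (m :+ d) :+ m :* (m :+ d) :+ d :* d := m :* m :+ (m :+ d) :* (m :+ d)) refl

m*n+m*n≤m*m+n*n : ∀ m n → m ℕ.* n ℕ.+ m ℕ.* n ℕ.≤ m ℕ.* m ℕ.+ n ℕ.* n
m*n+m*n≤m*m+n*n m n with ℕ.≤-total m n
... | inj₁ m≤n = m≤n⇒m*n+m*n≤m*m+n*n m≤n
... | inj₂ n≤m = subst₂ ℕ._≤_ (cong₂ ℕ._+_ (ℕ.*-comm n m) (ℕ.*-comm n m)) (ℕ.+-comm (n ℕ.* n) (m ℕ.* m))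
                   (m≤n⇒m*n+m*n≤m*m+n*n n≤m)

titu₂-cross-multiplied : ∀ a a' B B' →
  (a ℕ.+ a') ℕ.* (a ℕ.+ a') ℕ.* (B ℕ.* B') ℕ.≤ (a ℕ.* a ℕ.* B' ℕ.+ a' ℕ.* a' ℕ.* B) ℕ.* (B ℕ.+ B')
titu₂-cross-multiplied a a' B B' = begin
  (a ℕ.+ a') ℕ.* (a ℕ.+ a') ℕ.* (B ℕ.* B')           ≡⟨ expandˡ a a' B B' ⟩
  common ℕ.+ (a ℕ.* B' ℕ.* (a' ℕ.* B) ℕ.+ a ℕ.* B' ℕ.* (a' ℕ.* B))
    ≤⟨ ℕ.+-monoʳ-≤ common (m*n+m*n≤m*m+n*n (a ℕ.* B') (a' ℕ.* B)) ⟩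
  common ℕ.+ (a ℕ.* B' ℕ.* (a ℕ.* B') ℕ.+ a' ℕ.* B ℕ.* (a' ℕ.* B)) ≡⟨ expandʳ a a' B B' ⟨
  (a ℕ.* a ℕ.* B' ℕ.+ a' ℕ.* a' ℕ.* B) ℕ.* (B ℕ.+ B') ∎
  where
  open ℕ.≤-Reasoning
  open +-*-Solver
  common : ℕ
  common = a ℕ.* a ℕ.* B ℕ.* B' ℕ.+ a' ℕ.* a' ℕ.* B ℕ.* B'
  expandˡ : ∀ a a' B B' → (a ℕ.+ a') ℕ.* (a ℕ.+ a') ℕ.* (B ℕ.* B') ≡
    a ℕ.* a ℕ.* B ℕ.* B' ℕ.+ a' ℕ.* a' ℕ.* B ℕ.* B' ℕ.+ (a ℕ.* B' ℕ.* (a' ℕ.* B) ℕ.+ a ℕ.* B' ℕ.* (a' ℕ.* B))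
  expandˡ = solve 4 (λ a a' B B' → (a :+ a') :* (a :+ a') :* (B :* B') :=
    a :* a :* B :* B' :+ a' :* a' :* B :* B' :+ (a :* B' :* (a' :* B) :+ a :* B' :* (a' :* B))) refl
  expandʳ : ∀ a a' B B' → (a ℕ.* a ℕ.* B' ℕ.+ a' ℕ.* a' ℕ.* B) ℕ.* (B ℕ.+ B') ≡
    a ℕ.* a ℕ.* B ℕ.* B' ℕ.+ a' ℕ.* a' ℕ.* B ℕ.* B' ℕ.+ (a ℕ.* B' ℕ.* (a ℕ.* B') ℕ.+ a' ℕ.* B ℕ.* (a' ℕ.* B))
  expandʳ = solve 4 (λ a a' B B' → (a :* a :* B' :+ a' :* a' :* B) :* (B :+ B') :=
    a :* a :* B :* B' :+ a' :* a' :* B :* B' :+ (a :* B' :* (a :* B') :+ a' :* B :* (a' :* B))) refl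

fromℚᵘ-mono-≤ : ∀ {p q} → p ℚᵘ.≤ q → fromℚᵘ p ≤ fromℚᵘ q
fromℚᵘ-mono-≤ {p} {q} p≤q = toℚᵘ-cancel-≤
  (ℚᵘ.≤-respˡ-≃ (ℚᵘ.≃-sym (toℚᵘ-fromℚᵘ p)) (ℚᵘ.≤-respʳ-≃ (ℚᵘ.≃-sym (toℚᵘ-fromℚᵘ q)) p≤q))

fromℚᵘ-homo-+ : ∀ p q → fromℚᵘ (p ℚᵘ.+ q) ≡ fromℚᵘ p + fromℚᵘ q
fromℚᵘ-homo-+ p q = toℚᵘ-injective (ℚᵘ.≃-trans (toℚᵘ-fromℚᵘ (p ℚᵘ.+ q)) (ℚᵘ.≃-sym
  (ℚᵘ.≃-trans (toℚᵘ-homo-+ (fromℚᵘ p) (fromℚᵘ q)) (ℚᵘ.+-cong (toℚᵘ-fromℚᵘ p) (toℚᵘ-fromℚᵘ q)))))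

sqRatio-suc-+-≤ : ∀ a a' k k' →
                  sqRatio (a ℕ.+ a') (suc k ℕ.+ suc k') ≤ sqRatio a (suc k) + sqRatio a' (suc k')
-- sqRatio a (suc k) is definitionally fromℚᵘ (mkℚᵘ (+ (a * a)) k).
sqRatio-suc-+-≤ a a' k k' = begin
  fromℚᵘ r                    ≤⟨ fromℚᵘ-mono-≤ {r} {s ℚᵘ.+ s'} (*≤* cross-multiplied) ⟩
  fromℚᵘ (s ℚᵘ.+ s')          ≡⟨ fromℚᵘ-homo-+ s s' ⟩
  fromℚᵘ s + fromℚᵘ s'        ∎
  where
  open ≤-Reasoning
  A A' B B' : ℕ
  A = a ℕ.* a
  A' = a' ℕ.* a'
  B = suc k
  B' = suc k'
  r s s' : ℚᵘ
  r = mkℚᵘ (+ ((a ℕ.+ a') ℕ.* (a ℕ.+ a'))) (k ℕ.+ suc k')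
  s = mkℚᵘ (+ A) k
  s' = mkℚᵘ (+ A') k'
  cross-multiplied : + ((a ℕ.+ a') ℕ.* (a ℕ.+ a')) ℤ.* + (B ℕ.* B') ℤ.≤
                     (+ A ℤ.* + B' ℤ.+ + A' ℤ.* + B) ℤ.* + (B ℕ.+ B')
  cross-multiplied = subst₂ ℤ._≤_ (ℤ.pos-* ((a ℕ.+ a') ℕ.* (a ℕ.+ a')) (B ℕ.* B')) rhs-cast
                       (ℤ.+≤+ (titu₂-cross-multiplied a a' B B'))
    where
    rhs-cast : + ((A ℕ.* B' ℕ.+ A' ℕ.* B) ℕ.* (B ℕ.+ B')) ≡ (+ A ℤ.* + B' ℤ.+ + A' ℤ.* + B) ℤ.* + (B ℕ.+ B')
    rhs-cast = trans (ℤ.pos-* (A ℕ.* B' ℕ.+ A' ℕ.* B) (B ℕ.+ B'))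
      (cong (ℤ._* + (B ℕ.+ B'))
        (trans (ℤ.pos-+ (A ℕ.* B') (A' ℕ.* B)) (cong₂ ℤ._+_ (ℤ.pos-* A B') (ℤ.pos-* A' B))))

sqRatio-+-≤ : ∀ {a a' b b'} → (b ≡ 0 → a ≡ 0) → (b' ≡ 0 → a' ≡ 0) →
              sqRatio (a ℕ.+ a') (b ℕ.+ b') ≤ sqRatio a b + sqRatio a' b'
sqRatio-+-≤ {b = zero} b≡0⇒a≡0 _ rewrite b≡0⇒a≡0 refl = ≤-reflexive (sym (+-identityˡ _))
sqRatio-+-≤ {a} {b = suc k} {zero} _ b'≡0⇒a'≡0
  rewrite b'≡0⇒a'≡0 refl | ℕ.+-identityʳ a | ℕ.+-identityʳ k = ≤-reflexive (sym (+-identityʳ _))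
sqRatio-+-≤ {a} {a'} {suc k} {suc k'} _ _ = sqRatio-suc-+-≤ a a' k k'

sumℕ≡0⇒sumℕ≡0 : ∀ {n} {a b : Fin n → ℕ} → (∀ j → b j ≡ 0 → a j ≡ 0) → sumℕ b ≡ 0 → sumℕ a ≡ 0
sumℕ≡0⇒sumℕ≡0 {zero} _ _ = refl
sumℕ≡0⇒sumℕ≡0 {suc n} {a} {b} b≡0⇒a≡0 Σb≡0 = cong₂ ℕ._+_
  (b≡0⇒a≡0 zero (ℕ.m+n≡0⇒m≡0 (b zero) Σb≡0))
  (sumℕ≡0⇒sumℕ≡0 (λ j → b≡0⇒a≡0 (suc j)) (ℕ.m+n≡0⇒n≡0 (b zero) Σb≡0))

titu : ∀ {n} (a b : Fin n → ℕ) → (∀ j → b j ≡ 0 → a j ≡ 0) →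
       sqRatio (sumℕ a) (sumℕ b) ≤ sumℚ (λ j → sqRatio (a j) (b j))
titu {zero} _ _ _ = ≤-refl
titu {suc n} a b b≡0⇒a≡0 = ≤-trans
  (sqRatio-+-≤ (b≡0⇒a≡0 zero) (sumℕ≡0⇒sumℕ≡0 (λ j → b≡0⇒a≡0 (suc j))))
  (+-monoʳ-≤ (sqRatio (a zero) (b zero)) (titu (λ j → a (suc j)) (λ j → b (suc j)) (λ j → b≡0⇒a≡0 (suc j))))

sumℚ-mono-≤ : ∀ {n} {f g : Fin n → ℚ} → (∀ j → f j ≤ g j) → sumℚ f ≤ sumℚ g
sumℚ-mono-≤ {zero} _ = ≤-refl
sumℚ-mono-≤ {suc n} f≤g = +-mono-≤ (f≤g zero) (sumℚ-mono-≤ (λ j → f≤g (suc j)))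

sumℚ-nonNeg : ∀ {n} {f : Fin n → ℚ} → (∀ j → 0ℚ ≤ f j) → 0ℚ ≤ sumℚ f
sumℚ-nonNeg {zero} _ = ≤-refl
sumℚ-nonNeg {suc n} 0≤f = +-mono-≤ (0≤f zero) (sumℚ-nonNeg (λ j → 0≤f (suc j)))

*-distribˡ-sumℚ : ∀ {n} p (f : Fin n → ℚ) → p * sumℚ f ≡ sumℚ (λ j → p * f j)
*-distribˡ-sumℚ {zero} p _ = *-zeroʳ p
*-distribˡ-sumℚ {suc n} p f =
  trans (*-distribˡ-+ p (f zero) _) (cong (_+_ (p * f zero)) (*-distribˡ-sumℚ p (λ j → f (suc j))))

square-nonNeg : ∀ p → 0ℚ ≤ p * p
square-nonNeg p with ≤-total 0ℚ p
... | inj₁ 0≤p = nonNegative⁻¹ _ {{nonNeg*nonNeg⇒nonNeg p {{nonNegative 0≤p}} p {{nonNegative 0≤p}}}}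
... | inj₂ p≤0 = nonNegative⁻¹ _ {{nonPos*nonPos⇒nonPos p {{nonPositive p≤0}} p {{nonPositive p≤0}}}}

≤-*-of-≤-squares : ∀ {x y z} → 0ℚ ≤ y → 0ℚ ≤ z → x ≤ y * y → x ≤ z * z → x ≤ y * z
≤-*-of-≤-squares {y = y} {z} 0≤y 0≤z x≤y² x≤z² with ≤-total y z
... | inj₁ y≤z = ≤-trans x≤y² (*-monoˡ-≤-nonNeg y {{nonNegative 0≤y}} y≤z)
... | inj₂ z≤y = ≤-trans x≤z² (*-monoʳ-≤-nonNeg z {{nonNegative 0≤z}} z≤y)

p*p+p*q≤[p+½*q]*[p+½*q] : ∀ p q → p * p + p * q ≤ (p + ½ * q) * (p + ½ * q)
p*p+p*q≤[p+½*q]*[p+½*q] p q = begin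
  p * p + p * q                              ≡⟨ +-identityʳ _ ⟨
  p * p + p * q + 0ℚ                         ≤⟨ +-monoʳ-≤ (p * p + p * q) (square-nonNeg (½ * q)) ⟩
  p * p + p * q + ½ * q * (½ * q)            ≡⟨ expand p q ⟨
  (p + ½ * q) * (p + ½ * q)                  ∎
  where
  open ≤-Reasoning
  open ℚ-Solver
  expand : ∀ p q → (p + ½ * q) * (p + ½ * q) ≡ p * p + p * q + ½ * q * (½ * q)
  expand = solve 2 (λ p q → (p :+ con ½ :* q) :* (p :+ con ½ :* q) :=
                             p :* p :+ p :* q :+ con ½ :* q :* (con ½ :* q)) refl

lemma8 : (n : ℕ) (a b : Fin (suc n) → ℕ) →
         (∀ j → (b j ≡ 0) ⇔ (a j ≡ 0)) →
         (∀ j k → j < k → sqRatio (a k) (b k) ≤ sqRatio (a j) (b j)) →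
         (u : Fin (suc n) → ℚ) →
         (∀ j → UpperBoundOfRatio (a j) (b j) (u j)) →
         UpperBoundOfRatio (sumℕ a) (sumℕ b)
           (u zero + ½ * sumℚ (λ j → u (suc j)))
lemma8 n a b b≡0⇔a≡0 antitone u u-bound = 0≤U , Σa²/Σb≤U²
  where
  s : Fin (suc n) → ℚ
  s j = sqRatio (a j) (b j)
  u₀ T : ℚ
  u₀ = u zero
  T = sumℚ (λ j → u (suc j))
  0≤u : ∀ j → 0ℚ ≤ u j
  0≤u j = proj₁ (u-bound j)
  s≤u² : ∀ j → s j ≤ u j * u j
  s≤u² j = proj₂ (u-bound j)
  tail-s≤u₀*u : ∀ j → s (suc j) ≤ u₀ * u (suc j)
  tail-s≤u₀*u j = ≤-*-of-≤-squares (0≤u zero) (0≤u (suc j))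
    (≤-trans (antitone zero (suc j) (ℕ.s≤s ℕ.z≤n)) (s≤u² zero)) (s≤u² (suc j))
  0≤U : 0ℚ ≤ u₀ + ½ * T
  0≤U = +-mono-≤ (0≤u zero)
    (nonNegative⁻¹ _ {{nonNeg*nonNeg⇒nonNeg ½ T {{nonNegative (sumℚ-nonNeg (λ j → 0≤u (suc j)))}}}})
  Σa²/Σb≤U² : sqRatio (sumℕ a) (sumℕ b) ≤ (u₀ + ½ * T) * (u₀ + ½ * T)
  Σa²/Σb≤U² = begin
    sqRatio (sumℕ a) (sumℕ b)              ≤⟨ titu a b (λ j → Equivalence.to (b≡0⇔a≡0 j)) ⟩
    s zero + sumℚ (λ j → s (suc j))       ≤⟨ +-mono-≤ (s≤u² zero) (sumℚ-mono-≤ tail-s≤u₀*u) ⟩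
    u₀ * u₀ + sumℚ (λ j → u₀ * u (suc j))
      ≡⟨ cong (_+_ (u₀ * u₀)) (*-distribˡ-sumℚ u₀ (λ j → u (suc j))) ⟨
    u₀ * u₀ + u₀ * T                      ≤⟨ p*p+p*q≤[p+½*q]*[p+½*q] u₀ T ⟩
    (u₀ + ½ * T) * (u₀ + ½ * T)           ∎
    where open ≤-Reasoning
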